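{- Let $G$ be a finite group and let $S$ be a generating set of $G$ (with $e\notin S$) that contains an element $s$ of order $2$. Then Player 1 has a winning strategy for $\texttt{RAV}(G,S)$.
   Context: Game $\texttt{RAV}(G,S)$: $G$ is a finite group and $S$ a generating set with $e\notin S$. Two players alternate turns, Player 1 first, starting from the empty word $w_0$. On turn $n$ the current player chooses $s_n\in S\cup S^{ -1}$, subject to $s_n\neq s_{n-1}^{ -1}$ when $n>1$, and forms $w_n=w_{n-1}s_n$. If $w_n$ represents the same element of $G$ as some $w_k$ with $0\le k<n$, the player who formed $w_n$ loses. If a player has no legal move, that player loses. -}

module Defs where

open import Level using (Level; _⊔_)
open import Algebra.Bundles using (Group)
open import Data.Nat using (ℕ)
open import Data.Fin using (Fin)
open import Data.List using (List; []; _∷_; foldr)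
open import Data.List.Relation.Unary.Any using (Any)
open import Data.List.Relation.Unary.All using (All)
open import Data.Product using (Σ; ∃; _×_; _,_)
open import Data.Sum using (_⊎_)
open import Data.Unit.Polymorphic using (⊤)
open import Function.Bundles using (Inverse)
open import Relation.Nullary using (¬_)
import Relation.Binary.PropositionalEquality as ≡

IsFiniteGroup : ∀ {c ℓ} → Group c ℓ → Set (c ⊔ ℓ)
IsFiniteGroup G = ∃ λ (n : ℕ) → Inverse (Group.setoid G) (≡.setoid (Fin n))

module RAV {c ℓ} (G : Group c ℓ) (S : List (Group.Carrier G)) where
  open Group G

  _∈S : Carrier → Set (c ⊔ ℓ)
  x ∈S = Any (λ s → x ≈ s) S

  _∈S± : Carrier → Set (c ⊔ ℓ)
  x ∈S± = Any (λ s → x ≈ s ⊎ x ≈ s ⁻¹) S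

  prod : List Carrier → Carrier
  prod = foldr _∙_ ε

  Generates : Set (c ⊔ ℓ)
  Generates = ∀ g → ∃ λ (ws : List Carrier) → All _∈S± ws × (g ≈ prod ws)

  -- A position is the list of moves played so far, MOST RECENT FIRST:
  -- the history s_n ∷ … ∷ s_1 ∷ [] .
  -- value of the word w_n = s_1 s_2 ⋯ s_n
  val : List Carrier → Carrier
  val []       = ε
  val (m ∷ hs) = val hs ∙ m

  vals : List Carrier → List Carrier
  vals []       = ε ∷ []
  vals (m ∷ hs) = val (m ∷ hs) ∷ vals hs

  NoBacktrack : List Carrier → Carrier → Set ℓ
  NoBacktrack []      m = ⊤
  NoBacktrack (t ∷ _) m = ¬ (m ≈ t ⁻¹)

  Legal : List Carrier → Carrier → Set (c ⊔ ℓ)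
  Legal hs m = m ∈S± × NoBacktrack hs m

  Fresh : List Carrier → Carrier → Set (c ⊔ ℓ)
  Fresh hs m = ¬ Any (λ w → val hs ∙ m ≈ w) (vals hs)

  -- Lose hs : the player to move at position hs loses against best play
  --           (every legal move either revisits an element, losing at once,
  --            or leads to a position won by the opponent; in particular
  --            having no legal move is losing).
  -- Both are inductive, i.e. strategies that win in finitely many moves.
  data Win  (hs : List Carrier) : Set (c ⊔ ℓ)
  data Lose (hs : List Carrier) : Set (c ⊔ ℓ)

  data Win hs where
    win : (m : Carrier) → Legal hs m → Fresh hs m → Lose (m ∷ hs) → Win hs

  data Lose hs where
    lose : ((m : Carrier) → Legal hs m → Fresh hs m → Win (m ∷ hs)) → Lose hs

  Player1Wins : Set (c ⊔ ℓ)
  Player1Wins = Win []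

module Submission where

-- Player 1 opens with the involution s and answers every move of Player 2 by s again.
-- Then, whenever Player 2 is to move, the visited elements come in pairs {g, g s}:
-- the set of visited elements is closed under right multiplication by s. If Player 2
-- reaches a new element g, then g s is new as well (otherwise g = (g s) s would have
-- been visited) and differs from g, so Player 1's reply is always legal and fresh.
-- Since the visited elements are pairwise distinct, the game ends within |G| moves,
-- and it can only end with Player 2 stuck or losing.

open import Defs
open import Algebra.Bundles using (Group)
import Algebra.Properties.Group as GroupProperties
open import Data.Empty using (⊥-elim)
open import Data.Fin using (Fin; zero; suc)
open import Data.Fin.Properties using (injective⇒≤)
open import Data.List using (List; []; _∷_; length; lookup)
open import Data.List.Relation.Unary.All using ([])
open import Data.List.Relation.Unary.All.Properties using (All¬⇒¬Any; ¬Any⇒All¬)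
open import Data.List.Relation.Unary.Any as Any using (here; there)
import Data.List.Membership.Setoid as Membership
open import Data.List.Membership.Setoid.Properties using (∈-resp-≈; ∈-lookup)
open import Data.List.Relation.Unary.AllPairs using ([]; _∷_)
open import Data.List.Relation.Unary.Unique.Setoid using (Unique)
open import Data.Nat using (ℕ; zero; suc; _+_; _≤_; _<_)
open import Data.Nat.Properties using (≤-trans; ≤-reflexive; +-suc; +-identityʳ; m≤n⇒m≤1+n; m≤n+m; ≤⇒≯)
open import Data.Product using (Σ; _×_; _,_)
open import Data.Sum using (inj₁)
open import Data.Unit.Polymorphic using (tt)
open import Function.Bundles using (Injection)
open import Level using (_⊔_)
open import Function.Properties.Inverse using (Inverse⇒Injection)
open import Relation.Binary.Bundles using (Setoid)
open import Relation.Binary.PropositionalEquality as ≡ using (_≡_)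
open import Relation.Nullary using (¬_)

module _ {a ℓ} (S : Setoid a ℓ) where
  open Setoid S
  open Membership S using (_∈_; _∉_)

  x∉xs⇒Unique[x∷xs] : ∀ {x xs} → x ∉ xs → Unique S xs → Unique S (x ∷ xs)
  x∉xs⇒Unique[x∷xs] {x} {xs} x∉xs xs! = ¬Any⇒All¬ {P = x ≈_} xs x∉xs ∷ xs!

  lookup-injective : ∀ {xs} → Unique S xs →
                     ∀ i j → lookup xs i ≈ lookup xs j → i ≡ j
  lookup-injective (_ ∷ _) zero zero _ = ≡.refl
  lookup-injective {x ∷ xs} (x∉xs ∷ _) zero (suc j) x≈xⱼ =
    ⊥-elim (All¬⇒¬Any x∉xs (∈-resp-≈ S (sym x≈xⱼ) (∈-lookup S xs j)))
  lookup-injective {x ∷ xs} (x∉xs ∷ _) (suc i) zero xᵢ≈x =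
    ⊥-elim (All¬⇒¬Any x∉xs (∈-resp-≈ S xᵢ≈x (∈-lookup S xs i)))
  lookup-injective (_ ∷ xs!) (suc i) (suc j) xᵢ≈xⱼ =
    ≡.cong suc (lookup-injective xs! i j xᵢ≈xⱼ)

  unique⇒length≤ : ∀ {n xs} → Injection S (≡.setoid (Fin n)) → Unique S xs → length xs ≤ n
  unique⇒length≤ ι xs! =
    injective⇒≤ (λ eq → lookup-injective xs! _ _ (injective eq))
    where open Injection ι

  ∉⇒length< : ∀ {n x xs} → Injection S (≡.setoid (Fin n)) → Unique S xs → x ∉ xs → length xs < n
  ∉⇒length< ι xs! x∉xs = unique⇒length≤ ι (x∉xs⇒Unique[x∷xs] x∉xs xs!)

module Involution {c ℓ} (G : Group c ℓ) {s : Group.Carrier G}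
  (s≉ε : ¬ Group._≈_ G s (Group.ε G)) (s∙s≈ε : Group._≈_ G (Group._∙_ G s s) (Group.ε G)) where
  open Group G
  open GroupProperties G using (identityʳ-unique)
  open Membership setoid using (_∈_; _∉_)

  ∙s∙s≈id : ∀ g → (g ∙ s) ∙ s ≈ g
  ∙s∙s≈id g = begin
    (g ∙ s) ∙ s  ≈⟨ assoc g s s ⟩
    g ∙ (s ∙ s)  ≈⟨ ∙-congˡ s∙s≈ε ⟩
    g ∙ ε        ≈⟨ identityʳ g ⟩
    g            ∎
    where open import Relation.Binary.Reasoning.Setoid setoid

  ClosedUnder∙s : List Carrier → Set (c ⊔ ℓ)
  ClosedUnder∙s xs = ∀ {g} → g ∈ xs → g ∙ s ∈ xs

  closedUnder∙s-∷-pair : ∀ {g xs} → ClosedUnder∙s xs → ClosedUnder∙s (g ∙ s ∷ g ∷ xs)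
  closedUnder∙s-∷-pair _ (here h≈gs) = there (here (trans (∙-congʳ h≈gs) (∙s∙s≈id _)))
  closedUnder∙s-∷-pair _ (there (here h≈g)) = here (∙-congʳ h≈g)
  closedUnder∙s-∷-pair closed (there (there h∈xs)) = there (there (closed h∈xs))

  ∙s∉-∷ : ∀ {g xs} → ClosedUnder∙s xs → g ∉ xs → g ∙ s ∉ g ∷ xs
  ∙s∉-∷ {g} _ _ (here gs≈g) = s≉ε (identityʳ-unique g s gs≈g)
  ∙s∉-∷ {g} closed g∉xs (there gs∈xs) = g∉xs (∈-resp-≈ setoid (∙s∙s≈id g) (closed gs∈xs))

module Strategy {c ℓ} (G : Group c ℓ) (S : List (Group.Carrier G)) {n : ℕ}
  (finite : Injection (Group.setoid G) (≡.setoid (Fin n)))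
  {s : Group.Carrier G} (s∈S : RAV._∈S G S s)
  (s≉ε : ¬ Group._≈_ G s (Group.ε G)) (s∙s≈ε : Group._≈_ G (Group._∙_ G s s) (Group.ε G)) where
  open Group G
  open GroupProperties G using (⁻¹-selfInverse)
  open RAV G S
  open Involution G s≉ε s∙s≈ε

  record Paired (hs : List Carrier) : Set (c ⊔ ℓ) where
    field
      distinct : Unique setoid (vals hs)
      closed   : ClosedUnder∙s (vals hs)
  open Paired

  s∈S± : s ∈S±
  s∈S± = Any.map inj₁ s∈S

  legal-s-after : ∀ {h t} → Legal (s ∷ h) t → Legal (t ∷ s ∷ h) s
  legal-s-after (_ , t≉s⁻¹) = s∈S± , λ s≈t⁻¹ → t≉s⁻¹ (sym (⁻¹-selfInverse (sym s≈t⁻¹)))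

  opening : Fresh [] s × Paired (s ∷ [])
  opening = fresh , record
    { distinct = x∉xs⇒Unique[x∷xs] setoid fresh ([] ∷ [])
    ; closed   = closedUnder∙s-∷-pair λ ()
    }
    where
    fresh : Fresh [] s
    fresh = ∙s∉-∷ (λ ()) (λ ())

  answer : ∀ {hs t} → Paired hs → Fresh hs t → Fresh (t ∷ hs) s × Paired (s ∷ t ∷ hs)
  answer paired fresh = fresh′ , record
    { distinct = x∉xs⇒Unique[x∷xs] setoid fresh′ (x∉xs⇒Unique[x∷xs] setoid fresh (distinct paired))
    ; closed   = closedUnder∙s-∷-pair (closed paired)
    }
    where fresh′ = ∙s∉-∷ (closed paired) fresh

  player2Loses : ∀ k {h} → Paired (s ∷ h) → n ≤ length (vals (s ∷ h)) + k → Lose (s ∷ h)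
  player2Loses zero paired bound = lose λ _ _ fresh →
    ⊥-elim (≤⇒≯ (≤-trans bound (≤-reflexive (+-identityʳ _)))
                (∉⇒length< setoid finite (distinct paired) fresh))
  player2Loses (suc k) {h} paired bound = lose λ t legal fresh →
    let fresh′ , paired′ = answer paired fresh
    in win s (legal-s-after {h} legal) fresh′
         (player2Loses k paired′ (m≤n⇒m≤1+n (≤-trans bound (≤-reflexive (+-suc _ k)))))

  player1Wins : Player1Wins
  player1Wins = let fresh , paired = opening
                in win s (s∈S± , tt) fresh (player2Loses n paired (m≤n+m n 2))

theorem3p9 : ∀ {c ℓ} (G : Group c ℓ) → IsFiniteGroup G →
    (S : List (Group.Carrier G)) →
    RAV.Generates G S →
    (∀ x → RAV._∈S G S x → ¬ (Group._≈_ G x (Group.ε G))) →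
    Σ (Group.Carrier G) (λ s → RAV._∈S G S s ×
        ¬ (Group._≈_ G s (Group.ε G)) ×
        Group._≈_ G (Group._∙_ G s s) (Group.ε G)) →
    RAV.Player1Wins G S
theorem3p9 G (_ , finite) S _ _ (s , s∈S , s≉ε , s∙s≈ε) =
  Strategy.player1Wins G S (Inverse⇒Injection finite) s∈S s≉ε s∙s≈ε
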